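{- Let $\mathbf{x}\in\Sigma_3^\omega$, and suppose that for some $n\ge 0$ the word $\tau(g(f^n(\mathbf{x})))$ is $16/7$-power-free. Then $\mathbf{x}$ is $5$-power-free and even-$3$-power-free.
   Context: $\Sigma_3=\{0,1,2\}$. $f(0)=01$, $f(1)=022$, $f(2)=02$; $g(0)=20$, $g(1)=21$, $g(2)=2$. With $t_1(0)=001$, $t_1(1)=00101101$, $t_1(2)=0010110100101101$, $t_2(0)=002$, $t_2(1)=00202202$, $t_2(2)=0020220200202202$, $\tau(w_0w_1w_2\cdots)=t_1(w_0)t_2(w_1)t_1(w_2)t_2(w_3)\cdots$. A word $w$ is an $r$-power $p^r$ if $p$ is a prefix of $w$, $w$ has period $|p|$, and $|w|=r|p|$. A word is $\alpha$-power-free if it contains no factor that is an $r$-power with $r\ge\alpha$. An even-$r$-power is a word $p^r$ where $p$ contains an even number of $2$'s; a word is even-$r$-power-free if it contains no even-$r$-power as a factor. -}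

module Defs where

open import Data.Nat using (ℕ; zero; suc; _+_; _*_; _≤_; _%_)
open import Data.Fin using (Fin; zero; suc)
open import Data.List using (List; []; _∷_; _++_; concatMap; map; upTo)
open import Data.Bool using (Bool; true; false)
open import Data.Product using (_×_)
open import Relation.Binary.PropositionalEquality using (_≡_)
open import Relation.Nullary using (¬_)

Σ₃ : Set
Σ₃ = Fin 3

pattern a0 = zero
pattern a1 = suc zero
pattern a2 = suc (suc zero)

Word : Set
Word = ℕ → Σ₃

prefix : Word → ℕ → List Σ₃
prefix x n = map x (upTo n)

-- list lookup with a default value (the default is never reached below,
-- since all maps involved are non-erasing)
lookupD : List Σ₃ → ℕ → Σ₃
lookupD []       _       = a0
lookupD (a ∷ w) zero    = a
lookupD (a ∷ w) (suc i) = lookupD w i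

Morphism : Set
Morphism = Σ₃ → List Σ₃

-- image of an infinite word under a non-erasing morphism h:
-- the i-th letter of h(x) is the i-th letter of h(x₀…x_i)
applyω : Morphism → Word → Word
applyω h x i = lookupD (concatMap h (prefix x (suc i))) i

iterω : ℕ → Morphism → Word → Word
iterω zero    h x = x
iterω (suc n) h x = applyω h (iterω n h x)

f : Morphism
f a0 = a0 ∷ a1 ∷ []
f a1 = a0 ∷ a2 ∷ a2 ∷ []
f a2 = a0 ∷ a2 ∷ []

g : Morphism
g a0 = a2 ∷ a0 ∷ []
g a1 = a2 ∷ a1 ∷ []
g a2 = a2 ∷ []

t₁ : Morphism
t₁ a0 = a0 ∷ a0 ∷ a1 ∷ []
t₁ a1 = a0 ∷ a0 ∷ a1 ∷ a0 ∷ a1 ∷ a1 ∷ a0 ∷ a1 ∷ []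
t₁ a2 = t₁ a1 ++ t₁ a1

t₂ : Morphism
t₂ a0 = a0 ∷ a0 ∷ a2 ∷ []
t₂ a1 = a0 ∷ a0 ∷ a2 ∷ a0 ∷ a2 ∷ a2 ∷ a0 ∷ a2 ∷ []
t₂ a2 = t₂ a1 ++ t₂ a1

-- τ on finite words: t₁ at even positions, t₂ at odd positions
τL : Bool → List Σ₃ → List Σ₃
τL _     []      = []
τL true  (a ∷ w) = t₁ a ++ τL false w
τL false (a ∷ w) = t₂ a ++ τL true w

-- τ on infinite words (|t_i(a)| ≥ 3, so the i-th letter is determined by x₀…x_i)
τ : Word → Word
τ x i = lookupD (τL true (prefix x (suc i))) i

HasPeriodAt : Word → ℕ → ℕ → ℕ → Set
HasPeriodAt w i L p = ∀ j → j + p < L → w (i + j) ≡ w (i + j + p)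
  where open import Data.Nat using (_<_)

PowerFree : ℕ → ℕ → Word → Set
PowerFree num den w =
  ∀ i L p → 1 ≤ p → num * p ≤ den * L → ¬ HasPeriodAt w i L p

count2 : List Σ₃ → ℕ
count2 []        = 0
count2 (a2 ∷ w)  = suc (count2 w)
count2 (_ ∷ w)   = count2 w

factor : Word → ℕ → ℕ → List Σ₃
factor w i L = map (λ j → w (i + j)) (upTo L)

EvenPowerFree : ℕ → Word → Set
EvenPowerFree r w =
  ∀ i p → 1 ≤ p → count2 (factor w i p) % 2 ≡ 0 → ¬ HasPeriodAt w i (r * p) p

-- A non-erasing morphism maps a factor of period p and length c·p, with period word u, to a
-- factor of period |h(u)| and length c·|h(u)|.  So a 5-power of x survives f^n and g, and τ,
-- whose factors t₁ and t₂ have equal lengths and alternate with period 2, turns it into a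
-- factor of length 5Q and period 2Q, of exponent 5/2 ≥ 16/7.  For an even 3-power, f keeps the
-- number of 2's in the period word even, and |g(u)| has the parity of the number of 2's in u,
-- so g yields a 3-power of even period, on which τ acts like a morphism: a 3-power, 3 ≥ 16/7.
module Submission where

open import Defs
open import Data.Bool using (Bool; true; false)
open import Data.List using (List; []; _∷_; _++_; _∷ʳ_; concatMap; map; upTo; applyUpTo; length)
open import Data.List.Properties
  using (length-++; ++-assoc; ++-identityʳ; concatMap-++; concatMap-map; map-++; map-cong;
         length-map; length-upTo; upTo-∷ʳ; map-upTo)
open import Data.Nat using (ℕ; zero; suc; _+_; _*_; _∸_; _≤_; _<_; z≤n; s≤s; _%_; >-nonZero)
open import Data.Nat.DivMod using (%-distribˡ-+)
open import Data.Nat.Divisibility using (_∣_; divides; m%n≡0⇒n∣m)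
open import Data.Nat.Properties
open import Algebra.Properties.CommutativeSemigroup +-commutativeSemigroup
  using (xy∙z≈xz∙y; x∙yz≈xz∙y)
open import Data.Product using (_×_; _,_; proj₁; ∃-syntax)
open import Data.Sum using (inj₁; inj₂)
open import Function using (_∘_)
open import Relation.Binary.PropositionalEquality
open import Relation.Nullary using (¬_)

open ≡-Reasoning

NonErasing : {I A : Set} → (I → List A) → Set
NonErasing h = ∀ a → 1 ≤ length (h a)

Periodic : {A : Set} → (ℕ → A) → ℕ → ℕ → ℕ → Set
Periodic w i L p = ∀ j → j + p < L → w (i + j) ≡ w (i + j + p)

module _ {A : Set} {w : ℕ → A} {i L : ℕ} where

  Periodic-≤ : ∀ {L′ p} → L′ ≤ L → Periodic w i L p → Periodic w i L′ p
  Periodic-≤ L′≤L per j lt = per j (<-≤-trans lt L′≤L)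

  Periodic-+ : ∀ {p q} → Periodic w i L p → Periodic w i L q → Periodic w i L (p + q)
  Periodic-+ {p} {q} per-p per-q j lt = begin
    w (i + j)           ≡⟨ per-p j (≤-<-trans (+-monoʳ-≤ j (m≤m+n p q)) lt) ⟩
    w (i + j + p)       ≡⟨ cong w (+-assoc i j p) ⟩
    w (i + (j + p))     ≡⟨ per-q (j + p) (subst (_< L) (sym (+-assoc j p q)) lt) ⟩
    w (i + (j + p) + q) ≡⟨ cong w (trans (cong (_+ q) (sym (+-assoc i j p))) (+-assoc (i + j) p q)) ⟩
    w (i + j + (p + q)) ∎

  Periodic-* : ∀ k {p} → Periodic w i L p → Periodic w i L (k * p)
  Periodic-* zero    per j _ = cong w (sym (+-identityʳ (i + j)))
  Periodic-* (suc k) per     = Periodic-+ per (Periodic-* k per)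

Periodic-zip : {A C : Set} {w : ℕ → A} {i L p : ℕ} (h : ℕ → A → C) →
               (∀ m → h (m + p) ≡ h m) → Periodic w i L p → Periodic (λ m → h m (w m)) i L p
Periodic-zip h h-periodic per j lt = cong₂ (λ φ a → φ a) (sym (h-periodic _)) (per j lt)

HasPeriodAt-≗ : ∀ {w v i L p} → w ≗ v → HasPeriodAt w i L p → HasPeriodAt v i L p
HasPeriodAt-≗ w≗v per j lt = trans (sym (w≗v _)) (trans (per j lt) (w≗v _))

factor-≗ : ∀ {w v} → w ≗ v → ∀ i L → factor w i L ≡ factor v i L
factor-≗ w≗v i L = map-cong (λ j → w≗v (i + j)) (upTo L)

lookupD-++ˡ : ∀ u v {j} → j < length u → lookupD (u ++ v) j ≡ lookupD u j
lookupD-++ˡ (a ∷ u) v {zero}  _        = refl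
lookupD-++ˡ (a ∷ u) v {suc j} (s≤s lt) = lookupD-++ˡ u v lt

lookupD-++ʳ : ∀ u v j → lookupD (u ++ v) (length u + j) ≡ lookupD v j
lookupD-++ʳ []      v j = refl
lookupD-++ʳ (a ∷ u) v j = lookupD-++ʳ u v j

applyUpTo-lookupD : ∀ u (F : ℕ → Σ₃) → (∀ {j} → j < length u → F j ≡ lookupD u j) →
                    applyUpTo F (length u) ≡ u
applyUpTo-lookupD []      F F≡ = refl
applyUpTo-lookupD (a ∷ u) F F≡ =
  cong₂ _∷_ (F≡ (s≤s z≤n)) (applyUpTo-lookupD u (F ∘ suc) (λ lt → F≡ (s≤s lt)))

module _ {A : Set} (B : ℕ → List A) where

  blocks : ℕ → ℕ → List A
  blocks a zero    = []
  blocks a (suc d) = blocks a d ++ B (a + d)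

  blocks-+ : ∀ a d e → blocks a (d + e) ≡ blocks a d ++ blocks (a + d) e
  blocks-+ a d zero    = trans (cong (blocks a) (+-identityʳ d)) (sym (++-identityʳ _))
  blocks-+ a d (suc e) = begin
    blocks a (d + suc e)                              ≡⟨ cong (blocks a) (+-suc d e) ⟩
    blocks a (d + e) ++ B (a + (d + e))               ≡⟨ cong₂ _++_ (blocks-+ a d e) (cong B (sym (+-assoc a d e))) ⟩
    (blocks a d ++ blocks (a + d) e) ++ B (a + d + e) ≡⟨ ++-assoc (blocks a d) _ _ ⟩
    blocks a d ++ blocks (a + d) (suc e)              ∎

  blocks-shift : ∀ {a p} d → Periodic B a (d + p) p → blocks (a + p) d ≡ blocks a d
  blocks-shift         zero    per = refl
  blocks-shift {a} {p} (suc d) per =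
    cong₂ _++_ (blocks-shift d (Periodic-≤ {w = B} (n≤1+n _) per))
               (trans (cong B (xy∙z≈xz∙y a p d)) (sym (per d ≤-refl)))

  length-blocks-* : ∀ {a p} c → Periodic B a (c * p) p →
                    length (blocks a (c * p)) ≡ c * length (blocks a p)
  length-blocks-*         zero    per = refl
  length-blocks-* {a} {p} (suc c) per = begin
    length (blocks a (p + c * p))                         ≡⟨ cong length (blocks-+ a p (c * p)) ⟩
    length (blocks a p ++ blocks (a + p) (c * p))         ≡⟨ length-++ (blocks a p) ⟩
    length (blocks a p) + length (blocks (a + p) (c * p)) ≡⟨ cong (λ u → length (blocks a p) + length u)
                                                               (blocks-shift (c * p) per′) ⟩
    length (blocks a p) + length (blocks a (c * p))       ≡⟨ cong (length (blocks a p) +_)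
                                                               (length-blocks-* c (Periodic-≤ {w = B} (m≤n+m _ p) per)) ⟩
    length (blocks a p) + c * length (blocks a p)         ∎
    where
      per′ : Periodic B a (c * p + p) p
      per′ = subst (λ L → Periodic B a L p) (+-comm p (c * p)) per

  blocks-upTo : ∀ a d → blocks a d ≡ concatMap (λ j → B (a + j)) (upTo d)
  blocks-upTo a zero    = refl
  blocks-upTo a (suc d) = begin
    blocks a d ++ B (a + d)                        ≡⟨ cong₂ _++_ (blocks-upTo a d) (sym (++-identityʳ _)) ⟩
    concatMap G (upTo d) ++ concatMap G (d ∷ [])   ≡⟨ sym (concatMap-++ G (upTo d) (d ∷ [])) ⟩
    concatMap G (upTo d ∷ʳ d)                      ≡⟨ cong (concatMap G) (upTo-∷ʳ d) ⟩
    concatMap G (upTo (suc d))                     ∎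
    where
      G : ℕ → List A
      G j = B (a + j)

  length-blocks-≥ : NonErasing B → ∀ a d → d ≤ length (blocks a d)
  length-blocks-≥ ne a zero    = z≤n
  length-blocks-≥ ne a (suc d) =
    subst (suc d ≤_) (sym (length-++ (blocks a d)))
      (subst (_≤ length (blocks a d) + length (B (a + d))) (+-comm d 1) (+-mono-≤ (length-blocks-≥ ne a d) (ne (a + d))))

length-blocks-cong : {A : Set} {B B′ : ℕ → List A} → (∀ m → length (B m) ≡ length (B′ m)) →
                     ∀ a d → length (blocks B a d) ≡ length (blocks B′ a d)
length-blocks-cong             eq a zero    = refl
length-blocks-cong {B = B} {B′} eq a (suc d) = begin
  length (blocks B a d ++ B (a + d))             ≡⟨ length-++ (blocks B a d) ⟩
  length (blocks B a d) + length (B (a + d))     ≡⟨ cong₂ _+_ (length-blocks-cong eq a d) (eq (a + d)) ⟩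
  length (blocks B′ a d) + length (B′ (a + d))   ≡⟨ sym (length-++ (blocks B′ a d)) ⟩
  length (blocks B′ a d ++ B′ (a + d))           ∎

-- The infinite word B 0 B 1 B 2 ⋯; block m starts at position start m.  Letter N is read off the
-- first N + 1 blocks, which are long enough because the blocks are non-empty.
module Flatten (B : ℕ → List Σ₃) (B-nonErasing : NonErasing B) where

  start : ℕ → ℕ
  start n = length (blocks B 0 n)

  word : Word
  word N = lookupD (blocks B 0 (suc N)) N

  lookupD-blocks-prefix : ∀ {a m n j} → m ≤ n → j < length (blocks B a m) →
                          lookupD (blocks B a n) j ≡ lookupD (blocks B a m) j
  lookupD-blocks-prefix {a} {m} {n} {j} m≤n lt = begin
    lookupD (blocks B a n) j
      ≡⟨ cong (λ k → lookupD (blocks B a k) j) (sym (m+[n∸m]≡n m≤n)) ⟩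
    lookupD (blocks B a (m + (n ∸ m))) j                 ≡⟨ cong (λ u → lookupD u j) (blocks-+ B a m (n ∸ m)) ⟩
    lookupD (blocks B a m ++ blocks B (a + m) (n ∸ m)) j ≡⟨ lookupD-++ˡ (blocks B a m) _ lt ⟩
    lookupD (blocks B a m) j                             ∎

  word-prefix : ∀ {n N} → N < start n → word N ≡ lookupD (blocks B 0 n) N
  word-prefix {n} {N} lt with ≤-total (suc N) n
  ... | inj₁ 1+N≤n = sym (lookupD-blocks-prefix 1+N≤n (length-blocks-≥ B B-nonErasing 0 (suc N)))
  ... | inj₂ n≤1+N = lookupD-blocks-prefix n≤1+N lt

  word-blocks : ∀ a d {j} → j < length (blocks B a d) → word (start a + j) ≡ lookupD (blocks B a d) j
  word-blocks a d {j} lt = begin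
    word (start a + j)                                   ≡⟨ word-prefix {n = a + d} j<start ⟩
    lookupD (blocks B 0 (a + d)) (start a + j)           ≡⟨ cong (λ u → lookupD u (start a + j)) (blocks-+ B 0 a d) ⟩
    lookupD (blocks B 0 a ++ blocks B a d) (start a + j) ≡⟨ lookupD-++ʳ (blocks B 0 a) _ j ⟩
    lookupD (blocks B a d) j                             ∎
    where
      start-+ : start (a + d) ≡ start a + length (blocks B a d)
      start-+ = trans (cong length (blocks-+ B 0 a d)) (length-++ (blocks B 0 a))
      j<start : start a + j < start (a + d)
      j<start = subst (start a + j <_) (sym start-+) (+-monoʳ-< (start a) lt)

  factor-word : ∀ a d → factor word (start a) (length (blocks B a d)) ≡ blocks B a d
  factor-word a d = trans (map-upTo _ _) (applyUpTo-lookupD (blocks B a d) _ (word-blocks a d))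

  -- blocks a L is both X ++ V and V ++ Z for X = blocks a p, so it repeats itself at shift |X|.
  word-periodic : ∀ {a L p} → Periodic B a L p → p ≤ L →
                  HasPeriodAt word (start a) (length (blocks B a L)) (length (blocks B a p))
  word-periodic {a} {L} {p} per p≤L j lt = begin
    word (start a + j)                   ≡⟨ word-blocks a L j<u ⟩
    lookupD u j                          ≡⟨ cong (λ v → lookupD v j) u≡V++Z ⟩
    lookupD (V ++ Z) j                   ≡⟨ lookupD-++ˡ V Z j<V ⟩
    lookupD V j                          ≡⟨ sym (lookupD-++ʳ X V j) ⟩
    lookupD (X ++ V) (length X + j)      ≡⟨ cong (λ v → lookupD v (length X + j)) (sym u≡X++V) ⟩
    lookupD u (length X + j)             ≡⟨ sym (word-blocks a L X+j<u) ⟩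
    word (start a + (length X + j))      ≡⟨ cong word (x∙yz≈xz∙y (start a) (length X) j) ⟩
    word (start a + j + length X)        ∎
    where
      u X V Z : List Σ₃
      u = blocks B a L
      X = blocks B a p
      V = blocks B a (L ∸ p)
      Z = blocks B (a + (L ∸ p)) p
      u≡X++V : u ≡ X ++ V
      u≡X++V = begin
        blocks B a L                       ≡⟨ cong (blocks B a) (sym (m+[n∸m]≡n p≤L)) ⟩
        blocks B a (p + (L ∸ p))           ≡⟨ blocks-+ B a p (L ∸ p) ⟩
        X ++ blocks B (a + p) (L ∸ p)      ≡⟨ cong (X ++_) (blocks-shift B (L ∸ p)
                                                (subst (λ n → Periodic B a n p) (sym (m∸n+n≡m p≤L)) per)) ⟩
        X ++ V                             ∎
      u≡V++Z : u ≡ V ++ Z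
      u≡V++Z = trans (cong (blocks B a) (sym (m∸n+n≡m p≤L))) (blocks-+ B a (L ∸ p) p)
      X+j<u : length X + j < length u
      X+j<u = subst (_< length u) (+-comm j (length X)) lt
      j<u : j < length u
      j<u = ≤-<-trans (m≤m+n j _) lt
      j<V : j < length V
      j<V = +-cancelˡ-< (length X) j (length V)
              (subst (length X + j <_) (trans (cong length u≡X++V) (length-++ X)) X+j<u)

module MorphicImage (φ : Morphism) (φ-nonErasing : NonErasing φ) (y : Word) where
  open Flatten (φ ∘ y) (φ-nonErasing ∘ y) public

  blocks-factor : ∀ i p → blocks (φ ∘ y) i p ≡ concatMap φ (factor y i p)
  blocks-factor i p = trans (blocks-upTo (φ ∘ y) i p) (sym (concatMap-map φ _ (upTo p)))

  applyω≗word : applyω φ y ≗ word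
  applyω≗word N = cong (λ u → lookupD u N) (sym (blocks-factor 0 (suc N)))

  length-image-factor : ∀ i p → p ≤ length (concatMap φ (factor y i p))
  length-image-factor i p =
    subst (λ u → p ≤ length u) (blocks-factor i p) (length-blocks-≥ (φ ∘ y) (φ-nonErasing ∘ y) i p)

  image-periodic : ∀ {c i p} → 1 ≤ c → HasPeriodAt y i (c * p) p →
    let u = concatMap φ (factor y i p) in
    HasPeriodAt (applyω φ y) (start i) (c * length u) (length u) × factor (applyω φ y) (start i) (length u) ≡ u
  image-periodic {c} {i} {p} 1≤c per =
    HasPeriodAt-≗ (sym ∘ applyω≗word) periodic ,
    trans (factor-≗ applyω≗word (start i) (length u))
          (subst (λ v → factor word (start i) (length v) ≡ v) (blocks-factor i p) (factor-word i p))
    where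
      u : List Σ₃
      u = concatMap φ (factor y i p)
      perB : Periodic (φ ∘ y) i (c * p) p
      perB = Periodic-zip {w = y} (λ _ → φ) (λ _ → refl) per
      periodic : HasPeriodAt word (start i) (c * length u) (length u)
      periodic = subst₂ (HasPeriodAt word (start i))
                   (trans (length-blocks-* (φ ∘ y) c perB) (cong (λ v → c * length v) (blocks-factor i p)))
                   (cong length (blocks-factor i p))
                   (word-periodic perB (m≤n*m p c {{>-nonZero 1≤c}}))

Power : ℕ → Word → Set
Power c w = ∃[ i ] ∃[ p ] 1 ≤ p × HasPeriodAt w i (c * p) p

EvenPower : ℕ → Word → Set
EvenPower c w = ∃[ i ] ∃[ p ] 1 ≤ p × HasPeriodAt w i (c * p) p × count2 (factor w i p) % 2 ≡ 0

EvenPeriodPower : ℕ → Word → Set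
EvenPeriodPower c w = ∃[ i ] ∃[ p ] 1 ≤ p × 2 ∣ p × HasPeriodAt w i (c * p) p

Power-applyω : ∀ {c} φ → NonErasing φ → 1 ≤ c → ∀ y → Power c y → Power c (applyω φ y)
Power-applyω φ ne 1≤c y (i , p , 1≤p , per) =
  start i , _ , ≤-trans 1≤p (length-image-factor i p) , proj₁ (image-periodic 1≤c per)
  where open MorphicImage φ ne y

Power-iterω : ∀ {c} φ → NonErasing φ → 1 ≤ c → ∀ n x → Power c x → Power c (iterω n φ x)
Power-iterω φ ne 1≤c zero    x pow = pow
Power-iterω φ ne 1≤c (suc n) x pow = Power-applyω φ ne 1≤c (iterω n φ x) (Power-iterω φ ne 1≤c n x pow)

%2-cong-suc : ∀ m n → m % 2 ≡ n % 2 → suc m % 2 ≡ suc n % 2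
%2-cong-suc m n eq = begin
  suc m % 2         ≡⟨ %-distribˡ-+ 1 m 2 ⟩
  (1 + m % 2) % 2   ≡⟨ cong (λ k → (1 + k) % 2) eq ⟩
  (1 + n % 2) % 2   ≡⟨ sym (%-distribˡ-+ 1 n 2) ⟩
  suc n % 2         ∎

count2-concatMap-f : ∀ u → count2 (concatMap f u) % 2 ≡ count2 u % 2
count2-concatMap-f []       = refl
count2-concatMap-f (a0 ∷ u) = count2-concatMap-f u
count2-concatMap-f (a1 ∷ u) = count2-concatMap-f u
count2-concatMap-f (a2 ∷ u) = %2-cong-suc (count2 (concatMap f u)) (count2 u) (count2-concatMap-f u)

length-concatMap-g : ∀ u → length (concatMap g u) % 2 ≡ count2 u % 2
length-concatMap-g []       = refl
length-concatMap-g (a0 ∷ u) = length-concatMap-g u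
length-concatMap-g (a1 ∷ u) = length-concatMap-g u
length-concatMap-g (a2 ∷ u) = %2-cong-suc (length (concatMap g u)) (count2 u) (length-concatMap-g u)

f-nonErasing : NonErasing f
f-nonErasing a0 = s≤s z≤n
f-nonErasing a1 = s≤s z≤n
f-nonErasing a2 = s≤s z≤n

g-nonErasing : NonErasing g
g-nonErasing a0 = s≤s z≤n
g-nonErasing a1 = s≤s z≤n
g-nonErasing a2 = s≤s z≤n

EvenPower-applyω-f : ∀ {c} → 1 ≤ c → ∀ y → EvenPower c y → EvenPower c (applyω f y)
EvenPower-applyω-f 1≤c y (i , p , 1≤p , per , even) =
  let (periodic , factor≡) = image-periodic 1≤c per in
  start i , _ , ≤-trans 1≤p (length-image-factor i p) , periodic ,
  trans (cong (λ u → count2 u % 2) factor≡) (trans (count2-concatMap-f (factor y i p)) even)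
  where open MorphicImage f f-nonErasing y

EvenPower-iterω-f : ∀ {c} → 1 ≤ c → ∀ n x → EvenPower c x → EvenPower c (iterω n f x)
EvenPower-iterω-f 1≤c zero    x pow = pow
EvenPower-iterω-f 1≤c (suc n) x pow = EvenPower-applyω-f 1≤c (iterω n f x) (EvenPower-iterω-f 1≤c n x pow)

EvenPower-applyω-g : ∀ {c} → 1 ≤ c → ∀ y → EvenPower c y → EvenPeriodPower c (applyω g y)
EvenPower-applyω-g 1≤c y (i , p , 1≤p , per , even) =
  start i , _ , ≤-trans 1≤p (length-image-factor i p) ,
  m%n≡0⇒n∣m _ 2 (trans (length-concatMap-g (factor y i p)) even) ,
  proj₁ (image-periodic 1≤c per)
  where open MorphicImage g g-nonErasing y

τAt : ℕ → Morphism
τAt zero                = t₁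
τAt (suc zero)          = t₂
τAt (suc (suc m))       = τAt m

τAt-periodic : ∀ {p} → 2 ∣ p → ∀ m → τAt (m + p) ≡ τAt m
τAt-periodic (divides q refl) m = trans (cong τAt (+-comm m (q * 2))) (shift q)
  where
    shift : ∀ q → τAt (q * 2 + m) ≡ τAt m
    shift zero    = refl
    shift (suc q) = shift q

length-τAt : ∀ m a → length (τAt m a) ≡ length (t₁ a)
length-τAt zero          a  = refl
length-τAt (suc zero)    a0 = refl
length-τAt (suc zero)    a1 = refl
length-τAt (suc zero)    a2 = refl
length-τAt (suc (suc m)) a  = length-τAt m a

t₁-nonErasing : NonErasing t₁
t₁-nonErasing a0 = s≤s z≤n
t₁-nonErasing a1 = s≤s z≤n
t₁-nonErasing a2 = s≤s z≤n

phase : Bool → ℕ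
phase true  = 0
phase false = 1

τL-∷ʳ : ∀ b u a → τL b (u ∷ʳ a) ≡ τL b u ++ τAt (phase b + length u) a
τL-∷ʳ true  []      a = ++-identityʳ (t₁ a)
τL-∷ʳ false []      a = ++-identityʳ (t₂ a)
τL-∷ʳ true  (c ∷ u) a = trans (cong (t₁ c ++_) (τL-∷ʳ false u a)) (sym (++-assoc (t₁ c) _ _))
τL-∷ʳ false (c ∷ u) a = trans (cong (t₂ c ++_) (τL-∷ʳ true u a)) (sym (++-assoc (t₂ c) _ _))

module TauImage (z : Word) where
  B : ℕ → List Σ₃
  B m = τAt m (z m)

  B-nonErasing : NonErasing B
  B-nonErasing m = subst (1 ≤_) (sym (length-τAt m (z m))) (t₁-nonErasing (z m))

  open Flatten B B-nonErasing public

  τL-blocks : ∀ n → τL true (map z (upTo n)) ≡ blocks B 0 n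
  τL-blocks zero    = refl
  τL-blocks (suc n) = begin
    τL true (map z (upTo (suc n)))        ≡⟨ cong (τL true ∘ map z) (sym (upTo-∷ʳ n)) ⟩
    τL true (map z (upTo n ∷ʳ n))         ≡⟨ cong (τL true) (map-++ z (upTo n) (n ∷ [])) ⟩
    τL true (map z (upTo n) ∷ʳ z n)       ≡⟨ τL-∷ʳ true (map z (upTo n)) (z n) ⟩
    τL true (map z (upTo n)) ++ τAt (length (map z (upTo n))) (z n)
                                          ≡⟨ cong₂ (λ u k → u ++ τAt k (z n)) (τL-blocks n)
                                                   (trans (length-map z (upTo n)) (length-upTo n)) ⟩
    blocks B 0 n ++ τAt n (z n)           ∎

  τ≗word : τ z ≗ word
  τ≗word N = cong (λ u → lookupD u N) (τL-blocks (suc N))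

  Power-τ : ∀ {c} → 1 ≤ c → EvenPeriodPower c z → Power c (τ z)
  Power-τ {c} 1≤c (i , p , 1≤p , 2∣p , per) =
    start i , length (blocks B i p) ,
    ≤-trans 1≤p (length-blocks-≥ B B-nonErasing i p) ,
    HasPeriodAt-≗ (sym ∘ τ≗word)
      (subst (λ L → HasPeriodAt word (start i) L (length (blocks B i p)))
             (length-blocks-* B c perB) (word-periodic perB (m≤n*m p c {{>-nonZero 1≤c}})))
    where
      perB : Periodic B i (c * p) p
      perB = Periodic-zip {w = z} τAt (τAt-periodic 2∣p) per

  -- An odd period of z need not be a period of B, but its double is, and since t₁ and t₂
  -- have equal lengths, the images of p consecutive letters of z all have the same length Q.
  τ-power-doubled : ∀ {c} → 2 ≤ c → Power c z →
    ∃[ I ] ∃[ Q ] 1 ≤ Q × HasPeriodAt (τ z) I (c * Q) (2 * Q)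
  τ-power-doubled {c} 2≤c (i , p , 1≤p , per) =
    start i , Q , ≤-trans 1≤p (length-blocks-≥ (t₁ ∘ z) (t₁-nonErasing ∘ z) i p) ,
    HasPeriodAt-≗ (sym ∘ τ≗word)
      (subst₂ (HasPeriodAt word (start i)) (length-blocks c ≤-refl) (length-blocks 2 2p≤cp)
              (word-periodic per₂ₚ 2p≤cp))
    where
      Q : ℕ
      Q = length (blocks (t₁ ∘ z) i p)
      2p≤cp : 2 * p ≤ c * p
      2p≤cp = *-monoˡ-≤ p 2≤c
      per₂ₚ : Periodic B i (c * p) (2 * p)
      per₂ₚ = Periodic-zip {w = z} {i = i} τAt (τAt-periodic (divides p (*-comm 2 p))) (Periodic-* {w = z} {i = i} 2 per)
      length-blocks : ∀ k → k * p ≤ c * p → length (blocks B i (k * p)) ≡ k * Q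
      length-blocks k k*p≤c*p =
        trans (length-blocks-cong (λ m → length-τAt m (z m)) i (k * p))
              (length-blocks-* (t₁ ∘ z) k (Periodic-≤ {w = t₁ ∘ z} k*p≤c*p
                                             (Periodic-zip {w = z} (λ _ → t₁) (λ _ → refl) per)))

Power⇒¬PowerFree : ∀ {num den c w} → num ≤ den * c → Power c w → ¬ PowerFree num den w
Power⇒¬PowerFree {num} {den} {c} num≤den*c (i , p , 1≤p , per) free =
  free i (c * p) p 1≤p (subst (num * p ≤_) (*-assoc den c p) (*-monoˡ-≤ p num≤den*c)) per

τ-fifth-power : ∀ z → Power 5 z → ¬ PowerFree 16 7 (τ z)
τ-fifth-power z pow free =
  let (I , Q , 1≤Q , per′) = τ-power-doubled {c = 5} (s≤s (s≤s z≤n)) pow in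
  free I (5 * Q) (2 * Q) (≤-trans 1≤Q (m≤m+n Q _))
       (subst₂ _≤_ (*-assoc 16 2 Q) (*-assoc 7 5 Q) (*-monoˡ-≤ Q (m≤m+n 32 3))) per′
  where open TauImage z

τ-g-even-cube : ∀ y → EvenPower 3 y → ¬ PowerFree 16 7 (τ (applyω g y))
τ-g-even-cube y pow =
  Power⇒¬PowerFree {16} {7} {3} {τ (applyω g y)} (m≤m+n 16 5)
    (Power-τ {c = 3} (s≤s z≤n) (EvenPower-applyω-g {c = 3} (s≤s z≤n) y pow))
  where open TauImage (applyω g y)

lemma10 : (x : Word) → ∃[ n ] PowerFree 16 7 (τ (applyω g (iterω n f x))) →
    PowerFree 5 1 x × EvenPowerFree 3 x
lemma10 x (n , free) = fifth-power-free , even-cube-free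
  where
    y : Word
    y = iterω n f x
    fifth-power-free : PowerFree 5 1 x
    fifth-power-free i L p 1≤p 5p≤L per =
      τ-fifth-power (applyω g y) (Power-applyω {c = 5} g g-nonErasing (s≤s z≤n) y
        (Power-iterω {c = 5} f f-nonErasing (s≤s z≤n) n x
          (i , p , 1≤p , Periodic-≤ {w = x} (subst (5 * p ≤_) (*-identityˡ L) 5p≤L) per)))
        free
    even-cube-free : EvenPowerFree 3 x
    even-cube-free i p 1≤p even per =
      τ-g-even-cube y (EvenPower-iterω-f {c = 3} (s≤s z≤n) n x (i , p , 1≤p , per , even)) free
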